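{- Let $\pi\in T_n$ with $\mathrm{lis}(\pi)=k$, and let $(P,Q)$ be the pair of standard Young tableaux associated to $\pi$ by the Robinson–Schensted–Knuth correspondence ($P$ the insertion tableau, $Q$ the recording tableau). Let $\mathrm{srs}(\pi)$ be the sum of all entries in the second row of $P$ plus the sum of all entries in the second row of $Q$. Then $\mathrm{sign}(\pi)=(-1)^{\mathrm{srs}(\pi)+n-k}$.
   Context: $T_n$ denotes the set of $321$-avoiding permutations in $\mathcal S_n$ (no decreasing subsequence of length three). $\mathrm{lis}(\pi)$ is the length of a longest increasing subsequence of $\pi$. For $\pi\in T_n$ the RSK tableaux $P,Q$ have the same shape with at most two rows, the first row having length $\mathrm{lis}(\pi)$ (the second row has length $n-k$, possibly empty, in which case its entry sum is $0$). -}

module Defs where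

open import Data.Nat using (ℕ; zero; suc; _+_; _<_; _>_; _≤_; _<ᵇ_; _≤ᵇ_)
open import Data.Bool using (Bool; true; false; if_then_else_)
open import Data.List using (List; []; _∷_; _++_; length; map; upTo; [_])
open import Data.Nat.ListAction using (sum)
open import Data.Maybe using (Maybe; just; nothing)
open import Data.Product using (_×_; _,_; proj₁; proj₂; ∃)
open import Data.Integer using (ℤ; -_) renaming (_*_ to _*ℤ_)
open import Data.List.Relation.Binary.Sublist.Propositional using (_⊆_)
open import Data.List.Relation.Unary.Linked using (Linked)
open import Relation.Nullary using (¬_)
open import Relation.Binary.PropositionalEquality using (_≡_)

-- A permutation of {1,…,n} is given in one-line notation as a list w = π(1) … π(n).

-- i-th entry (0-based) of a list, default 0
at : List ℕ → ℕ → ℕ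
at []       _       = 0
at (x ∷ xs) zero    = x
at (x ∷ xs) (suc i) = at xs i

Avoids321 : List ℕ → Set
Avoids321 w = ¬ (∃ λ i → ∃ λ j → ∃ λ l →
  i < j × j < l × l < length w × at w i > at w j × at w j > at w l)

IsIncSubseq : List ℕ → List ℕ → Set
IsIncSubseq s w = s ⊆ w × Linked _<_ s

IsLIS : List ℕ → ℕ → Set
IsLIS w k = (∃ λ s → IsIncSubseq s w × length s ≡ k)
          × (∀ s → IsIncSubseq s w → length s ≤ k)

negOnePow : ℕ → ℤ
negOnePow zero    = ℤ.pos 1
negOnePow (suc m) = - negOnePow m

countLess : ℕ → List ℕ → ℕ
countLess x []       = 0
countLess x (y ∷ ys) = (if y <ᵇ x then 1 else 0) + countLess x ys

inv : List ℕ → ℕ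
inv []       = 0
inv (x ∷ xs) = countLess x xs + inv xs

sign : List ℕ → ℤ
sign w = negOnePow (inv w)

-- Robinson–Schensted–Knuth row insertion.
-- A tableau is a list of rows (top row first), each row a list of entries.
Tableau : Set
Tableau = List (List ℕ)

rowInsert : ℕ → List ℕ → Maybe ℕ × List ℕ
rowInsert x []       = nothing , x ∷ []
rowInsert x (y ∷ ys) with x <ᵇ y
... | true  = just y , x ∷ ys
... | false with rowInsert x ys
...   | b , ys' = b , y ∷ ys'

-- insert x into a tableau; also returns the (0-based) index of the row
-- in which the new box appears
insertT : ℕ → Tableau → Tableau × ℕ
insertT x []       = (x ∷ []) ∷ [] , 0
insertT x (r ∷ rs) with rowInsert x r
... | nothing , r' = r' ∷ rs , 0
... | just y  , r' with insertT y rs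
...   | rs' , i = r' ∷ rs' , suc i

addAt : ℕ → ℕ → Tableau → Tableau
addAt v zero    []       = (v ∷ []) ∷ []
addAt v zero    (r ∷ rs) = (r ++ v ∷ []) ∷ rs
addAt v (suc i) []       = [] ∷ addAt v i []
addAt v (suc i) (r ∷ rs) = r ∷ addAt v i rs

-- process the word left to right; t is the position (1-based) of the next letter
rskFrom : ℕ → List ℕ → Tableau × Tableau → Tableau × Tableau
rskFrom t []       PQ = PQ
rskFrom t (x ∷ xs) (P , Q) with insertT x P
... | P' , i = rskFrom (suc t) xs (P' , addAt t i Q)

rsk : List ℕ → Tableau × Tableau
rsk w = rskFrom 1 w ([] , [])

secondRow : Tableau → List ℕ
secondRow (_ ∷ r ∷ _) = r
secondRow _           = []

srs : List ℕ → ℕ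
srs w = sum (secondRow (proj₁ (rsk w))) + sum (secondRow (proj₂ (rsk w)))

-- Run Robinson–Schensted insertion on a 321-avoiding word w letter by letter, keeping P = (R₁, R₂)
-- and Q = (Q₁, Q₂) with at most two rows. A letter y bumped out of R₁ by x < y exceeds all of R₂:
-- we keep, for every r ∈ R₁ and b ∈ R₂ with r < b, a descent a > c of w with c ≥ r, and for r = y
-- the letters a, c, x would form a 321 pattern. By Schensted, the number of entries of R₁ below v
-- is the length of a longest increasing subsequence of w with entries below v, so |R₁| = lis(w).
-- For the sign, inv(w) ≡ Σ_{b ∈ R₂} #{a ∈ w | a < b} + ΣQ₂ (mod 2): appending x to R₁ adds
-- #{b ∈ R₂ | b > x} to both sides, while bumping y adds #{a ∈ w | a > x} to the left side and that
-- plus the even number 2(#{a ∈ w | a < y} + 1) to the right side. Finally, in a permutation of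
-- 1, …, n exactly b − 1 letters are below b, so the rank sum is ΣR₂ − |R₂| = ΣR₂ − (n − k).

module Submission where

open import Data.Bool using (true; false)
open import Data.Integer using (-_)
open import Data.Integer.Properties using (neg-involutive)
open import Data.List using (List; []; _∷_; _++_; [_]; length; filter; map; upTo; applyUpTo)
open import Data.List.Membership.Propositional using (_∈_; _∉_)
open import Data.List.Membership.Propositional.Properties using (∈-++⁺ˡ; ∈-++⁺ʳ; ∈-++⁻; ∈-map⁻; ∈-upTo⁻)
open import Data.List.Properties
  using (length-++; length-filter; length-map; length-upTo; filter-++; filter-all; filter-none; ++-assoc; ++-identityʳ; map-upTo)
open import Data.List.Relation.Binary.Permutation.Propositional
  using (_↭_; prep; swap; ↭-refl; ↭-sym; ↭-trans; ↭⇒↭ₛ; module PermutationReasoning)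
open import Data.List.Relation.Binary.Permutation.Propositional.Properties
  using (↭-length; filter-↭; ++-comm; ++⁺ˡ; ++⁺ʳ; All-resp-↭; ∈-resp-↭)
open import Data.List.Relation.Binary.Sublist.Propositional using (_⊆_; []; _∷_; _∷ʳ_; ⊆-refl; ⊆-trans; from∈)
import Data.List.Relation.Binary.Sublist.Propositional.Properties as Sublist
open import Data.List.Relation.Unary.All using (All; []; _∷_)
import Data.List.Relation.Unary.All as All
import Data.List.Relation.Unary.All.Properties as All
open import Data.List.Relation.Unary.AllPairs using (AllPairs; []; _∷_)
import Data.List.Relation.Unary.AllPairs.Properties as AllPairs
open import Data.List.Relation.Unary.Any using (here; there)
open import Data.List.Relation.Unary.Linked using (Linked; []; [-]; _∷_)
open import Data.List.Relation.Unary.Unique.Propositional using (Unique)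
import Data.List.Relation.Unary.Unique.Propositional.Properties as Unique
open import Data.Maybe using (just; nothing)
open import Data.Nat using (ℕ; zero; suc; _+_; _∸_; _<_; _≤_; z≤n; s≤s; _<?_; _≤?_; _<ᵇ_)
open import Data.Nat.ListAction using (sum)
open import Data.Nat.ListAction.Properties using (sum-++)
open import Data.Nat.Properties
open import Data.Nat.Tactic.RingSolver using (solve-∀)
open import Data.Product using (_×_; _,_; proj₁; proj₂; ∃-syntax; map₂)
open import Data.Sum using (_⊎_; inj₁; inj₂)
open import Function using (_∘_)
open import Level using (Level)
open import Relation.Binary.PropositionalEquality
  using (_≡_; _≢_; refl; sym; trans; cong; cong₂; subst; subst₂; setoid; module ≡-Reasoning)
open import Relation.Nullary using (¬_; yes; no; contradiction; ofʸ; ofⁿ)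
open import Relation.Unary using (Pred; Decidable; ∁)
open import Relation.Unary.Properties using (∁?)
open import Algebra.Properties.CommutativeSemigroup +-commutativeSemigroup using (interchange)
import Data.List.Relation.Binary.Permutation.Setoid.Properties (setoid ℕ) as PermutationSetoid

open import Defs

private variable
  a p q : Level
  A : Set a

count : {P : Pred A p} → Decidable P → List A → ℕ
count P? xs = length (filter P? xs)

module _ {P : Pred A p} (P? : Decidable P) where

  count-++ : ∀ xs ys → count P? (xs ++ ys) ≡ count P? xs + count P? ys
  count-++ xs ys = trans (cong length (filter-++ P? xs ys)) (length-++ (filter P? xs))

  count-↭ : ∀ {xs ys} → xs ↭ ys → count P? xs ≡ count P? ys
  count-↭ xs↭ys = ↭-length (filter-↭ P? xs↭ys)

  count-≤-++ : ∀ xs ys → count P? xs ≤ count P? (xs ++ ys)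
  count-≤-++ xs ys = ≤-trans (m≤m+n _ _) (≤-reflexive (sym (count-++ xs ys)))

  count-≤-length : ∀ xs → count P? xs ≤ length xs
  count-≤-length = length-filter P?

  count-all : ∀ {xs} → All P xs → count P? xs ≡ length xs
  count-all Pxs = cong length (filter-all P? Pxs)

  count-none : ∀ {xs} → All (∁ P) xs → count P? xs ≡ 0
  count-none ¬Pxs = cong length (filter-none P? ¬Pxs)

  count-[x]-accept : ∀ {x} → P x → count P? [ x ] ≡ 1
  count-[x]-accept {x} Px with P? x
  ... | yes _  = refl
  ... | no ¬Px = contradiction Px ¬Px

  count-[x]-reject : ∀ {x} → ¬ P x → count P? [ x ] ≡ 0
  count-[x]-reject {x} ¬Px with P? x
  ... | yes Px = contradiction Px ¬Px
  ... | no  _  = refl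

  count-∁ : ∀ xs → count P? xs + count (∁? P?) xs ≡ length xs
  count-∁ []       = refl
  count-∁ (x ∷ xs) with P? x
  ... | yes _ = cong suc (count-∁ xs)
  ... | no  _ = trans (+-suc _ _) (cong suc (count-∁ xs))

count-mono : {P : Pred A p} {Q : Pred A q} (P? : Decidable P) (Q? : Decidable Q) →
             ∀ {xs} → All (λ x → P x → Q x) xs → count P? xs ≤ count Q? xs
count-mono P? Q? []                 = z≤n
count-mono P? Q? {x ∷ xs} (P⇒Q ∷ h) with P? x | Q? x
... | yes _  | yes _  = s≤s (count-mono P? Q? h)
... | yes Px | no ¬Qx = contradiction (P⇒Q Px) ¬Qx
... | no _   | yes _  = m≤n⇒m≤1+n (count-mono P? Q? h)
... | no _   | no _   = count-mono P? Q? h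

count-cong : {P : Pred A p} {Q : Pred A q} (P? : Decidable P) (Q? : Decidable Q) →
             ∀ {xs} → All (λ x → P x → Q x) xs → All (λ x → Q x → P x) xs → count P? xs ≡ count Q? xs
count-cong P? Q? P⇒Q Q⇒P = ≤-antisym (count-mono P? Q? P⇒Q) (count-mono Q? P? Q⇒P)

below above atLeast : ℕ → List ℕ → ℕ
below v   = count (_<? v)
above x   = count (x <?_)
atLeast y = count (∁? (_<? y))

below-mono : ∀ {m n} → m ≤ n → ∀ xs → below m xs ≤ below n xs
below-mono m≤n xs = count-mono (_<? _) (_<? _) (All.universal (λ _ z<m → <-≤-trans z<m m≤n) xs)

below-∷ʳ-< : ∀ R {x v} → x < v → below v (R ++ [ x ]) ≡ suc (below v R)
below-∷ʳ-< R {x} {v} x<v = begin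
  below v (R ++ [ x ])      ≡⟨ count-++ (_<? v) R [ x ] ⟩
  below v R + below v [ x ] ≡⟨ cong (below v R +_) (count-[x]-accept (_<? v) x<v) ⟩
  below v R + 1             ≡⟨ +-comm _ 1 ⟩
  suc (below v R)           ∎
  where open ≡-Reasoning

below-∷ʳ-≥ : ∀ R {x v} → v ≤ x → below v (R ++ [ x ]) ≡ below v R
below-∷ʳ-≥ R {x} {v} v≤x = begin
  below v (R ++ [ x ])      ≡⟨ count-++ (_<? v) R [ x ] ⟩
  below v R + below v [ x ] ≡⟨ cong (below v R +_) (count-[x]-reject (_<? v) (≤⇒≯ v≤x)) ⟩
  below v R + 0             ≡⟨ +-identityʳ _ ⟩
  below v R                 ∎
  where open ≡-Reasoning

-- Split on y <ᵇ x, not on y <? x: does (y <? x) reduces to y <ᵇ x, which is what both sides mention.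
countLess≡below : ∀ x ys → countLess x ys ≡ below x ys
countLess≡below x []       = refl
countLess≡below x (y ∷ ys) with y <ᵇ x
... | true  = cong suc (countLess≡below x ys)
... | false = countLess≡below x ys

below-[x]≡above-[z] : ∀ x z → below z [ x ] ≡ above x [ z ]
below-[x]≡above-[z] x z with x <ᵇ z
... | true  = refl
... | false = refl

inv-∷ʳ : ∀ w x → inv (w ++ [ x ]) ≡ inv w + above x w
inv-∷ʳ []      x = refl
inv-∷ʳ (z ∷ w) x = begin
  countLess z (w ++ [ x ]) + inv (w ++ [ x ])
    ≡⟨ cong₂ _+_ (trans (countLess≡below z (w ++ [ x ])) (count-++ (_<? z) w [ x ])) (inv-∷ʳ w x) ⟩
  (below z w + below z [ x ]) + (inv w + above x w)
    ≡⟨ cong (λ c → (below z w + c) + (inv w + above x w)) (below-[x]≡above-[z] x z) ⟩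
  (below z w + above x [ z ]) + (inv w + above x w)
    ≡⟨ interchange (below z w) (above x [ z ]) (inv w) (above x w) ⟩
  (below z w + inv w) + (above x [ z ] + above x w)
    ≡⟨ cong₂ _+_ (cong (_+ inv w) (sym (countLess≡below z w))) (sym (count-++ (x <?_) [ z ] w)) ⟩
  inv (z ∷ w) + above x (z ∷ w) ∎
  where open ≡-Reasoning

negOnePow-congˡ : ∀ k {m n} → negOnePow m ≡ negOnePow n → negOnePow (k + m) ≡ negOnePow (k + n)
negOnePow-congˡ zero    eq = eq
negOnePow-congˡ (suc k) eq = cong -_ (negOnePow-congˡ k eq)

negOnePow-double+ : ∀ m n → negOnePow (m + m + n) ≡ negOnePow n
negOnePow-double+ zero    n = refl
negOnePow-double+ (suc m) n = begin
  - negOnePow (m + suc m + n)   ≡⟨ cong (λ j → - negOnePow (j + n)) (+-suc m m) ⟩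
  - - negOnePow (m + m + n)     ≡⟨ neg-involutive _ ⟩
  negOnePow (m + m + n)         ≡⟨ negOnePow-double+ m n ⟩
  negOnePow n                   ∎
  where open ≡-Reasoning

length-∷ʳ : ∀ (s : List A) x → length (s ++ [ x ]) ≡ suc (length s)
length-∷ʳ s x = trans (length-++ s) (+-comm (length s) 1)

Unique-++⇒≢ : ∀ {xs ys : List A} {a b} → Unique (xs ++ ys) → a ∈ xs → b ∈ ys → a ≢ b
Unique-++⇒≢ {xs = _ ∷ xs} (a≢ ∷ _) (here refl) b∈ys = All.lookup a≢ (∈-++⁺ʳ xs b∈ys)
Unique-++⇒≢ {xs = _ ∷ xs} (_ ∷ u)  (there a∈xs) b∈ys = Unique-++⇒≢ u a∈xs b∈ys

Unique-++⁻ˡ : ∀ (xs : List A) {ys} → Unique (xs ++ ys) → Unique xs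
Unique-++⁻ˡ []       _         = []
Unique-++⁻ˡ (x ∷ xs) (x≢ ∷ u) = All.++⁻ˡ xs x≢ ∷ Unique-++⁻ˡ xs u

Unique-resp-↭ : ∀ {xs ys : List ℕ} → xs ↭ ys → Unique xs → Unique ys
Unique-resp-↭ xs↭ys = PermutationSetoid.Unique-resp-↭ (↭⇒↭ₛ xs↭ys)

⊆-∷ʳ⁻ : ∀ {s : List A} w x → s ⊆ w ++ [ x ] → s ⊆ w ⊎ ∃[ s′ ] s ≡ s′ ++ [ x ] × s′ ⊆ w
⊆-∷ʳ⁻ []      x (.x ∷ʳ []) = inj₁ []
⊆-∷ʳ⁻ []      x (refl ∷ []) = inj₂ ([] , refl , [])
⊆-∷ʳ⁻ (y ∷ w) x (.y ∷ʳ τ) with ⊆-∷ʳ⁻ w x τ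
... | inj₁ τ′               = inj₁ (y ∷ʳ τ′)
... | inj₂ (s′ , refl , τ′) = inj₂ (s′ , refl , y ∷ʳ τ′)
⊆-∷ʳ⁻ (y ∷ w) x (refl ∷ τ) with ⊆-∷ʳ⁻ w x τ
... | inj₁ τ′               = inj₁ (refl ∷ τ′)
... | inj₂ (s′ , refl , τ′) = inj₂ (y ∷ s′ , refl , refl ∷ τ′)

Linked-∷ʳ⁻ : ∀ s {x} → Linked _<_ (s ++ [ x ]) → Linked _<_ s × All (_< x) s
Linked-∷ʳ⁻ []           _            = [] , []
Linked-∷ʳ⁻ (a ∷ [])     (a<x ∷ [-])  = [-] , a<x ∷ []
Linked-∷ʳ⁻ (a ∷ b ∷ s)  (a<b ∷ lk) with Linked-∷ʳ⁻ (b ∷ s) lk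
... | lk′ , b<x ∷ s<x = a<b ∷ lk′ , <-trans a<b b<x ∷ b<x ∷ s<x

Linked-∷ʳ⁺ : ∀ s {x} → Linked _<_ s → All (_< x) s → Linked _<_ (s ++ [ x ])
Linked-∷ʳ⁺ []          _          _             = [-]
Linked-∷ʳ⁺ (a ∷ [])    _          (a<x ∷ [])    = a<x ∷ [-]
Linked-∷ʳ⁺ (a ∷ b ∷ s) (a<b ∷ lk) (_ ∷ s<x)     = a<b ∷ Linked-∷ʳ⁺ (b ∷ s) lk s<x

IsIncSubseq-∷ʳ⁻ : ∀ {s} w x → IsIncSubseq s (w ++ [ x ]) →
                  IsIncSubseq s w ⊎ ∃[ s′ ] s ≡ s′ ++ [ x ] × IsIncSubseq s′ w × All (_< x) s′
IsIncSubseq-∷ʳ⁻ w x (τ , lk) with ⊆-∷ʳ⁻ w x τ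
... | inj₁ τ′ = inj₁ (τ′ , lk)
... | inj₂ (s′ , refl , τ′) with Linked-∷ʳ⁻ s′ lk
...   | lk′ , s′<x = inj₂ (s′ , refl , (τ′ , lk′) , s′<x)

IsIncSubseq-∷ʳ⁺ : ∀ {s w x} → IsIncSubseq s w → All (_< x) s → IsIncSubseq (s ++ [ x ]) (w ++ [ x ])
IsIncSubseq-∷ʳ⁺ {s} (τ , lk) s<x = Sublist.++⁺ τ ⊆-refl , Linked-∷ʳ⁺ s lk s<x

IsIncSubseq-++ʳ : ∀ {s w} xs → IsIncSubseq s w → IsIncSubseq s (w ++ xs)
IsIncSubseq-++ʳ xs (τ , lk) = Sublist.++⁺ʳ xs τ , lk

-- Schensted's theorem for the first row

record Schensted (w R : List ℕ) : Set where
  field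
    lis-≤ : ∀ v {s} → IsIncSubseq s w → All (_< v) s → length s ≤ below v R
    lis-≥ : ∀ v → ∃[ s ] IsIncSubseq s w × All (_< v) s × below v R ≤ length s

schensted-[] : Schensted [] []
schensted-[] = record
  { lis-≤ = λ { _ ([] , _) _ → z≤n }
  ; lis-≥ = λ _ → [] , ([] , []) , [] , z≤n
  }

schensted-lis : ∀ {w R v} → Schensted w R → All (_< v) w → IsLIS w (below v R)
schensted-lis {v = v} S w<v with Schensted.lis-≥ S v
... | s , inc , s<v , le =
  (s , inc , ≤-antisym (lis-≤ v inc s<v) le) ,
  λ s inc → lis-≤ v inc (Sublist.All-resp-⊆ (proj₁ inc) w<v)
  where open Schensted S

IsLIS-unique : ∀ {w k m} → IsLIS w k → IsLIS w m → k ≡ m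
IsLIS-unique ((s , inc , refl) , ≤k) ((s′ , inc′ , refl) , ≤m) = ≤-antisym (≤m s inc) (≤k s′ inc′)

-- The counting form of Schensted's recurrence lis_v(w x) = max (lis_v w) (1 + lis_x w) for x < v,
-- where lis_v is the longest increasing subsequence with entries below v.
record RowStep (x : ℕ) (R R′ : List ℕ) : Set where
  field
    below-≤      : ∀ v → below v R ≤ below v R′
    below-extend : ∀ {v} → x < v → suc (below x R) ≤ below v R′
    below-max    : ∀ v → below v R′ ≤ below v R ⊎ x < v × below v R′ ≤ suc (below x R)

schensted-step : ∀ {w R R′ x} → Schensted w R → RowStep x R R′ → Schensted (w ++ [ x ]) R′
schensted-step {w} {R} {R′} {x} S step = record { lis-≤ = upper ; lis-≥ = lower }
  where
  open Schensted S
  open RowStep step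

  upper : ∀ v {s} → IsIncSubseq s (w ++ [ x ]) → All (_< v) s → length s ≤ below v R′
  upper v inc s<v with IsIncSubseq-∷ʳ⁻ w x inc
  ... | inj₁ inc′ = ≤-trans (lis-≤ v inc′ s<v) (below-≤ v)
  ... | inj₂ (s′ , refl , inc′ , s′<x) = begin
    length (s′ ++ [ x ]) ≡⟨ length-∷ʳ s′ x ⟩
    suc (length s′)      ≤⟨ s≤s (lis-≤ x inc′ s′<x) ⟩
    suc (below x R)      ≤⟨ below-extend (All.head (All.++⁻ʳ s′ s<v)) ⟩
    below v R′           ∎
    where open ≤-Reasoning

  lower : ∀ v → ∃[ s ] IsIncSubseq s (w ++ [ x ]) × All (_< v) s × below v R′ ≤ length s
  lower v with below-max v
  ... | inj₁ ≤below with lis-≥ v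
  ...   | s , inc , s<v , le = s , IsIncSubseq-++ʳ [ x ] inc , s<v , ≤-trans ≤below le
  lower v | inj₂ (x<v , ≤extend) with lis-≥ x
  ...   | s , inc , s<x , le =
    s ++ [ x ] , IsIncSubseq-∷ʳ⁺ inc s<x , All.++⁺ (All.map (λ z<x → <-trans z<x x<v) s<x) (x<v ∷ []) ,
    ≤-trans ≤extend (≤-trans (s≤s le) (≤-reflexive (sym (length-∷ʳ s x))))

Sorted : List ℕ → Set
Sorted = AllPairs _<_

record Bump (x y : ℕ) (R R′ : List ℕ) : Set where
  field
    x<y      : x < y
    y∈R      : y ∈ R
    exchange : R′ ++ [ y ] ↭ R ++ [ x ]
    gap      : All (λ r → r < x ⊎ y ≤ r) R
    sorted   : Sorted R′

data RowInsertion (x : ℕ) (R : List ℕ) : Set where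
  append : All (_< x) R → RowInsertion x R
  bump   : ∀ {y R′} → rowInsert x R ≡ (just y , R′) → Bump x y R R′ → RowInsertion x R

rowInsert-bumpHead : ∀ {x y} ys → x < y → rowInsert x (y ∷ ys) ≡ (just y , x ∷ ys)
rowInsert-bumpHead {x} {y} ys x<y with x <ᵇ y | <ᵇ-reflects-< x y
... | true  | _         = refl
... | false | ofⁿ x≮y  = contradiction x<y x≮y

rowInsert-skipHead : ∀ {x y} ys → ¬ x < y → rowInsert x (y ∷ ys) ≡ map₂ (y ∷_) (rowInsert x ys)
rowInsert-skipHead {x} {y} ys x≮y with x <ᵇ y | <ᵇ-reflects-< x y
... | true  | ofʸ x<y  = contradiction x<y x≮y
... | false | _ with rowInsert x ys
...   | _ = refl

rowInsert-append : ∀ {x R} → All (_< x) R → rowInsert x R ≡ (nothing , R ++ [ x ])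
rowInsert-append []                      = refl
rowInsert-append {R = y ∷ ys} (y<x ∷ ys<x) =
  trans (rowInsert-skipHead ys (<⇒≯ y<x)) (cong (map₂ (y ∷_)) (rowInsert-append ys<x))

rowInsertion : ∀ {x R} → Sorted R → x ∉ R → RowInsertion x R
rowInsertion {x} {[]}     _                  _   = append []
rowInsertion {x} {y ∷ ys} (y<ys ∷ ys-sorted) x∉R with x <? y
... | yes x<y = bump (rowInsert-bumpHead ys x<y) record
  { x<y      = x<y
  ; y∈R      = here refl
  ; exchange = ↭-trans (++-comm (x ∷ ys) [ y ]) (↭-trans (swap y x ↭-refl) (↭-sym (++-comm (y ∷ ys) [ x ])))
  ; gap      = inj₂ ≤-refl ∷ All.map (inj₂ ∘ <⇒≤) y<ys
  ; sorted   = All.map (<-trans x<y) y<ys ∷ ys-sorted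
  }
... | no x≮y = prepend (≤∧≢⇒< (≮⇒≥ x≮y) (x∉R ∘ here ∘ sym)) (rowInsertion ys-sorted (x∉R ∘ there))
  where
  skip : ∀ {r} → rowInsert x ys ≡ r → rowInsert x (y ∷ ys) ≡ map₂ (y ∷_) r
  skip eq = trans (rowInsert-skipHead ys x≮y) (cong (map₂ (y ∷_)) eq)

  prepend : y < x → RowInsertion x ys → RowInsertion x (y ∷ ys)
  prepend y<x (append ys<x)    = append (y<x ∷ ys<x)
  prepend y<x (bump eq b)      = bump (skip eq) record
    { x<y      = x<y
    ; y∈R      = there y∈R
    ; exchange = prep y exchange
    ; gap      = inj₁ y<x ∷ gap
    ; sorted   = All.++⁻ˡ _ (All-resp-↭ (↭-sym exchange) (All.++⁺ y<ys (y<x ∷ []))) ∷ sorted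
    }
    where open Bump b

rowStep-append : ∀ {x R} → All (_< x) R → RowStep x R (R ++ [ x ])
rowStep-append {x} {R} R<x = record
  { below-≤      = λ v → count-≤-++ (_<? v) R [ x ]
  ; below-extend = below-extend
  ; below-max    = below-max
  }
  where
  below-extend : ∀ {v} → x < v → suc (below x R) ≤ below v (R ++ [ x ])
  below-extend {v} x<v = ≤-trans (s≤s (below-mono (<⇒≤ x<v) R)) (≤-reflexive (sym (below-∷ʳ-< R x<v)))

  below-max : ∀ v → below v (R ++ [ x ]) ≤ below v R ⊎ x < v × below v (R ++ [ x ]) ≤ suc (below x R)
  below-max v with x <? v
  ... | no x≮v  = inj₁ (≤-reflexive (below-∷ʳ-≥ R (≮⇒≥ x≮v)))
  ... | yes x<v = inj₂ (x<v , (begin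
    below v (R ++ [ x ]) ≡⟨ below-∷ʳ-< R x<v ⟩
    suc (below v R)      ≤⟨ s≤s (count-≤-length (_<? v) R) ⟩
    suc (length R)       ≡⟨ cong suc (sym (count-all (_<? x) R<x)) ⟩
    suc (below x R)      ∎))
    where open ≤-Reasoning

module _ {x y R R′} (b : Bump x y R R′) where
  open Bump b

  below-gap : ∀ {v} → x ≤ v → v ≤ y → below v R ≡ below x R
  below-gap {v} x≤v v≤y =
    count-cong (_<? v) (_<? x) (All.map below-x gap) (All.map (λ _ r<x → <-≤-trans r<x x≤v) gap)
    where
    below-x : ∀ {r} → r < x ⊎ y ≤ r → r < v → r < x
    below-x (inj₁ r<x) _   = r<x
    below-x (inj₂ y≤r) r<v = contradiction (≤-trans v≤y y≤r) (<⇒≱ r<v)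

  atLeast≡above : atLeast y R ≡ above x R
  atLeast≡above = count-cong (∁? (_<? y)) (x <?_) (All.map above-x gap) (All.map not-below-y gap)
    where
    above-x : ∀ {r} → r < x ⊎ y ≤ r → ¬ r < y → x < r
    above-x (inj₁ r<x) r≮y = contradiction (<-trans r<x x<y) r≮y
    above-x (inj₂ y≤r) _   = <-≤-trans x<y y≤r
    not-below-y : ∀ {r} → r < x ⊎ y ≤ r → x < r → ¬ r < y
    not-below-y (inj₁ r<x) x<r = contradiction r<x (<⇒≯ x<r)
    not-below-y (inj₂ y≤r) _   = ≤⇒≯ y≤r

  below-bump-inside : ∀ {v} → x < v → v ≤ y → below v R′ ≡ suc (below v R)
  below-bump-inside {v} x<v v≤y = begin
    below v R′             ≡⟨ below-∷ʳ-≥ R′ v≤y ⟨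
    below v (R′ ++ [ y ])  ≡⟨ count-↭ (_<? v) exchange ⟩
    below v (R ++ [ x ])   ≡⟨ below-∷ʳ-< R x<v ⟩
    suc (below v R)        ∎
    where open ≡-Reasoning

  below-bump-outside : ∀ {v} → v ≤ x ⊎ y < v → below v R′ ≡ below v R
  below-bump-outside {v} (inj₁ v≤x) = begin
    below v R′             ≡⟨ below-∷ʳ-≥ R′ (≤-trans v≤x (<⇒≤ x<y)) ⟨
    below v (R′ ++ [ y ])  ≡⟨ count-↭ (_<? v) exchange ⟩
    below v (R ++ [ x ])   ≡⟨ below-∷ʳ-≥ R v≤x ⟩
    below v R              ∎
    where open ≡-Reasoning
  below-bump-outside {v} (inj₂ y<v) = suc-injective (begin
    suc (below v R′)       ≡⟨ below-∷ʳ-< R′ y<v ⟨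
    below v (R′ ++ [ y ])  ≡⟨ count-↭ (_<? v) exchange ⟩
    below v (R ++ [ x ])   ≡⟨ below-∷ʳ-< R (<-trans x<y y<v) ⟩
    suc (below v R)        ∎)
    where open ≡-Reasoning

  rowStep-bump : RowStep x R R′
  rowStep-bump = record
    { below-≤      = below-≤
    ; below-extend = below-extend
    ; below-max    = below-max
    }
    where
    below-≤ : ∀ v → below v R ≤ below v R′
    below-≤ v with x <? v | y <? v
    ... | no x≮v  | _      = ≤-reflexive (sym (below-bump-outside (inj₁ (≮⇒≥ x≮v))))
    ... | yes _   | yes y<v = ≤-reflexive (sym (below-bump-outside (inj₂ y<v)))
    ... | yes x<v | no y≮v  = ≤-trans (n≤1+n _) (≤-reflexive (sym (below-bump-inside x<v (≮⇒≥ y≮v))))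

    below-extend : ∀ {v} → x < v → suc (below x R) ≤ below v R′
    below-extend {v} x<v = begin
      suc (below x R)        ≤⟨ s≤s (below-mono (n≤1+n x) R) ⟩
      suc (below (suc x) R)  ≡⟨ below-bump-inside (n<1+n x) x<y ⟨
      below (suc x) R′       ≤⟨ below-mono x<v R′ ⟩
      below v R′             ∎
      where open ≤-Reasoning

    below-max : ∀ v → below v R′ ≤ below v R ⊎ x < v × below v R′ ≤ suc (below x R)
    below-max v with x <? v | y <? v
    ... | no x≮v  | _       = inj₁ (≤-reflexive (below-bump-outside (inj₁ (≮⇒≥ x≮v))))
    ... | yes _   | yes y<v = inj₁ (≤-reflexive (below-bump-outside (inj₂ y<v)))
    ... | yes x<v | no y≮v  = inj₂ (x<v , ≤-reflexive
      (trans (below-bump-inside x<v (≮⇒≥ y≮v)) (cong suc (below-gap (<⇒≤ x<v) (≮⇒≥ y≮v)))))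

Contains321 : List ℕ → Set
Contains321 w = ∃[ a ] ∃[ b ] ∃[ c ] (a ∷ b ∷ c ∷ []) ⊆ w × b < a × c < b

Contains321-⊆ : ∀ {w w′} → w ⊆ w′ → Contains321 w → Contains321 w′
Contains321-⊆ τ (a , b , c , σ , b<a , c<b) = a , b , c , ⊆-trans σ τ , b<a , c<b

⊆⇒position₁ : ∀ {c w} → [ c ] ⊆ w → ∃[ l ] l < length w × at w l ≡ c
⊆⇒position₁ (_ ∷ʳ τ) with ⊆⇒position₁ τ
... | l , l<∣w∣ , wₗ≡c = suc l , s≤s l<∣w∣ , wₗ≡c
⊆⇒position₁ (refl ∷ _) = 0 , s≤s z≤n , refl

⊆⇒positions₂ : ∀ {b c w} → (b ∷ c ∷ []) ⊆ w →
               ∃[ j ] ∃[ l ] j < l × l < length w × at w j ≡ b × at w l ≡ c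
⊆⇒positions₂ (_ ∷ʳ τ) with ⊆⇒positions₂ τ
... | j , l , j<l , l<∣w∣ , wⱼ≡b , wₗ≡c = suc j , suc l , s≤s j<l , s≤s l<∣w∣ , wⱼ≡b , wₗ≡c
⊆⇒positions₂ (refl ∷ τ) with ⊆⇒position₁ τ
... | l , l<∣w∣ , wₗ≡c = 0 , suc l , s≤s z≤n , s≤s l<∣w∣ , refl , wₗ≡c

⊆⇒positions₃ : ∀ {a b c w} → (a ∷ b ∷ c ∷ []) ⊆ w →
               ∃[ i ] ∃[ j ] ∃[ l ] i < j × j < l × l < length w × at w i ≡ a × at w j ≡ b × at w l ≡ c
⊆⇒positions₃ (_ ∷ʳ τ) with ⊆⇒positions₃ τ
... | i , j , l , i<j , j<l , l<∣w∣ , eqs = suc i , suc j , suc l , s≤s i<j , s≤s j<l , s≤s l<∣w∣ , eqs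
⊆⇒positions₃ (refl ∷ τ) with ⊆⇒positions₂ τ
... | j , l , j<l , l<∣w∣ , wⱼ≡b , wₗ≡c =
  0 , suc j , suc l , s≤s z≤n , s≤s j<l , s≤s l<∣w∣ , refl , wⱼ≡b , wₗ≡c

Avoids321⇒¬Contains321 : ∀ {w} → Avoids321 w → ¬ Contains321 w
Avoids321⇒¬Contains321 avoids (_ , _ , _ , τ , b<a , c<b) with ⊆⇒positions₃ τ
... | i , j , l , i<j , j<l , l<∣w∣ , refl , refl , refl = avoids (i , j , l , i<j , j<l , l<∣w∣ , b<a , c<b)

DescentAbove : ℕ → List ℕ → Set
DescentAbove r w = ∃[ a ] ∃[ c ] (a ∷ c ∷ []) ⊆ w × c < a × r ≤ c

DescentAbove-++ʳ : ∀ {r w} xs → DescentAbove r w → DescentAbove r (w ++ xs)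
DescentAbove-++ʳ xs (a , c , τ , c<a , r≤c) = a , c , Sublist.++⁺ʳ xs τ , c<a , r≤c

DescentAbove⇒Contains321 : ∀ {r w x} → DescentAbove r w → x < r → Contains321 (w ++ [ x ])
DescentAbove⇒Contains321 {x = x} (a , c , τ , c<a , r≤c) x<r =
  a , c , x , Sublist.++⁺ τ ⊆-refl , c<a , <-≤-trans x<r r≤c

-- The two-row invariant

rankSum : List ℕ → List ℕ → ℕ
rankSum w []      = 0
rankSum w (b ∷ R) = below b w + rankSum w R

rankSum-row-∷ʳ : ∀ w R y → rankSum w (R ++ [ y ]) ≡ rankSum w R + below y w
rankSum-row-∷ʳ w []      y = +-identityʳ (below y w)
rankSum-row-∷ʳ w (b ∷ R) y = trans (cong (below b w +_) (rankSum-row-∷ʳ w R y)) (sym (+-assoc (below b w) _ _))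

rankSum-word-∷ʳ : ∀ w x R → rankSum (w ++ [ x ]) R ≡ rankSum w R + above x R
rankSum-word-∷ʳ w x []      = refl
rankSum-word-∷ʳ w x (b ∷ R) = begin
  below b (w ++ [ x ]) + rankSum (w ++ [ x ]) R
    ≡⟨ cong₂ _+_ (count-++ (_<? b) w [ x ]) (rankSum-word-∷ʳ w x R) ⟩
  (below b w + below b [ x ]) + (rankSum w R + above x R)
    ≡⟨ cong (λ c → (below b w + c) + (rankSum w R + above x R)) (below-[x]≡above-[z] x b) ⟩
  (below b w + above x [ b ]) + (rankSum w R + above x R)
    ≡⟨ interchange (below b w) (above x [ b ]) (rankSum w R) (above x R) ⟩
  (below b w + rankSum w R) + (above x [ b ] + above x R)
    ≡⟨ cong (below b w + rankSum w R +_) (sym (count-++ (x <?_) [ b ] R)) ⟩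
  rankSum w (b ∷ R) + above x (b ∷ R) ∎
  where open ≡-Reasoning

record TwoRowInvariant (w R₁ R₂ Q₂ : List ℕ) : Set where
  field
    content   : w ↭ R₁ ++ R₂
    sorted    : Sorted R₁
    descent   : ∀ {r b} → r ∈ R₁ → b ∈ R₂ → r < b → DescentAbove r w
    schensted : Schensted w R₁
    parity    : negOnePow (inv w) ≡ negOnePow (rankSum w R₂ + sum Q₂)

invariant-[] : TwoRowInvariant [] [] [] []
invariant-[] = record
  { content   = ↭-refl
  ; sorted    = []
  ; descent   = λ ()
  ; schensted = schensted-[]
  ; parity    = refl
  }

module _ {w R₁ R₂ Q₂} (I : TwoRowInvariant w R₁ R₂ Q₂) where
  open TwoRowInvariant I

  ∈R₁⇒∈w : ∀ {r} → r ∈ R₁ → r ∈ w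
  ∈R₁⇒∈w r∈R₁ = ∈-resp-↭ (↭-sym content) (∈-++⁺ˡ r∈R₁)

  fresh∉R₁ : ∀ {x} → Unique (w ++ [ x ]) → x ∉ R₁
  fresh∉R₁ distinct x∈R₁ = Unique-++⇒≢ distinct (∈R₁⇒∈w x∈R₁) (here refl) refl

  ∈R₂⇒∈w : ∀ {b} → b ∈ R₂ → b ∈ w
  ∈R₂⇒∈w b∈R₂ = ∈-resp-↭ (↭-sym content) (∈-++⁺ʳ R₁ b∈R₂)

  above-content : ∀ x → above x w ≡ above x R₁ + above x R₂
  above-content x = trans (count-↭ (x <?_) content) (count-++ (x <?_) R₁ R₂)

  content-append : ∀ x → w ++ [ x ] ↭ (R₁ ++ [ x ]) ++ R₂
  content-append x = begin
    w ++ [ x ]           ↭⟨ ++⁺ʳ [ x ] content ⟩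
    (R₁ ++ R₂) ++ [ x ]  ≡⟨ ++-assoc R₁ R₂ [ x ] ⟩
    R₁ ++ (R₂ ++ [ x ])  ↭⟨ ++⁺ˡ R₁ (++-comm R₂ [ x ]) ⟩
    R₁ ++ ([ x ] ++ R₂)  ≡⟨ ++-assoc R₁ [ x ] R₂ ⟨
    (R₁ ++ [ x ]) ++ R₂  ∎
    where open PermutationReasoning

  parity-append : ∀ {x} → All (_< x) R₁ →
                  negOnePow (inv (w ++ [ x ])) ≡ negOnePow (rankSum (w ++ [ x ]) R₂ + sum Q₂)
  parity-append {x} R₁<x = begin
    negOnePow (inv (w ++ [ x ]))
      ≡⟨ cong negOnePow (trans (inv-∷ʳ w x) (+-comm (inv w) _)) ⟩
    negOnePow (above x w + inv w)
      ≡⟨ cong (λ g → negOnePow (g + inv w)) (above-content x) ⟩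
    negOnePow (above x R₁ + above x R₂ + inv w)
      ≡⟨ cong (λ g → negOnePow (g + above x R₂ + inv w)) above-R₁ ⟩
    negOnePow (above x R₂ + inv w)
      ≡⟨ negOnePow-congˡ (above x R₂) parity ⟩
    negOnePow (above x R₂ + (rankSum w R₂ + sum Q₂))
      ≡⟨ cong negOnePow (rearrange (above x R₂) (rankSum w R₂) (sum Q₂)) ⟩
    negOnePow (rankSum w R₂ + above x R₂ + sum Q₂)
      ≡⟨ cong (λ ρ → negOnePow (ρ + sum Q₂)) (rankSum-word-∷ʳ w x R₂) ⟨
    negOnePow (rankSum (w ++ [ x ]) R₂ + sum Q₂) ∎
    where
    open ≡-Reasoning
    above-R₁ : above x R₁ ≡ 0
    above-R₁ = count-none (x <?_) (All.map <⇒≯ R₁<x)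
    rearrange : ∀ g ρ s → g + (ρ + s) ≡ ρ + g + s
    rearrange = solve-∀

  invariant-append : ∀ {x} → All (_< x) R₁ → TwoRowInvariant (w ++ [ x ]) (R₁ ++ [ x ]) R₂ Q₂
  invariant-append {x} R₁<x = record
    { content   = content-append x
    ; sorted    = AllPairs.++⁺ sorted ([] ∷ []) (All.map (_∷ []) R₁<x)
    ; descent   = descent′
    ; schensted = schensted-step schensted (rowStep-append R₁<x)
    ; parity    = parity-append R₁<x
    }
    where
    descent′ : ∀ {r b} → r ∈ R₁ ++ [ x ] → b ∈ R₂ → r < b → DescentAbove r (w ++ [ x ])
    descent′ r∈ b∈R₂ r<b with ∈-++⁻ R₁ r∈
    ... | inj₁ r∈R₁         = DescentAbove-++ʳ [ x ] (descent r∈R₁ b∈R₂ r<b)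
    ... | inj₂ (here refl) = _ , x , Sublist.++⁺ (from∈ (∈R₂⇒∈w b∈R₂)) ⊆-refl , r<b , ≤-refl

  module _ {x y R₁′} (b : Bump x y R₁ R₁′) where
    open Bump b using (x<y; y∈R; exchange; gap)

    R₂-below-bumped : Unique w → ¬ Contains321 (w ++ [ x ]) → All (_< y) R₂
    R₂-below-bumped distinct no321 = All.tabulate below-y
      where
      below-y : ∀ {b} → b ∈ R₂ → b < y
      below-y {b} b∈R₂ with b <? y
      ... | yes b<y = b<y
      ... | no  b≮y = contradiction (DescentAbove⇒Contains321 (descent y∈R b∈R₂ y<b) x<y) no321
        where y<b = ≤∧≢⇒< (≮⇒≥ b≮y) (Unique-++⇒≢ (Unique-resp-↭ content distinct) y∈R b∈R₂)

    module _ (R₂<y : All (_< y) R₂) where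

      -- The letters of w that are not below y lie in R₁, where by the gap they are those above x.
      length-bump : length w ≡ below y w + above x R₁
      length-bump = begin
        length w                           ≡⟨ count-∁ (_<? y) w ⟨
        below y w + atLeast y w            ≡⟨ cong (below y w +_) (count-↭ (∁? (_<? y)) content) ⟩
        below y w + atLeast y (R₁ ++ R₂)   ≡⟨ cong (below y w +_) (count-++ (∁? (_<? y)) R₁ R₂) ⟩
        below y w + (atLeast y R₁ + atLeast y R₂)
          ≡⟨ cong (λ m → below y w + (atLeast y R₁ + m)) R₂-atLeast ⟩
        below y w + (atLeast y R₁ + 0)
          ≡⟨ cong (below y w +_) (trans (+-identityʳ _) (atLeast≡above b)) ⟩
        below y w + above x R₁             ∎
        where
        open ≡-Reasoning
        R₂-atLeast : atLeast y R₂ ≡ 0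
        R₂-atLeast = count-none (∁? (_<? y)) (All.map (λ b<y b≮y → b≮y b<y) R₂<y)

      parity-bump : negOnePow (inv (w ++ [ x ])) ≡
                    negOnePow (rankSum (w ++ [ x ]) (R₂ ++ [ y ]) + sum (Q₂ ++ [ suc (length w) ]))
      parity-bump = begin
        negOnePow (inv (w ++ [ x ]))
          ≡⟨ cong negOnePow (trans (inv-∷ʳ w x) (+-comm (inv w) _)) ⟩
        negOnePow (above x w + inv w)
          ≡⟨ negOnePow-congˡ (above x w) parity ⟩
        negOnePow (above x w + (ρ + S))
          ≡⟨ cong (λ g → negOnePow (g + (ρ + S))) (above-content x) ⟩
        negOnePow (G₁ + G₂ + (ρ + S))
          ≡⟨ negOnePow-double+ (suc L) _ ⟨
        negOnePow (suc L + suc L + (G₁ + G₂ + (ρ + S)))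
          ≡⟨ cong negOnePow (rearrange L G₁ G₂ ρ S) ⟩
        negOnePow ((ρ + G₂ + suc L) + (S + suc (L + G₁)))
          ≡⟨ cong₂ (λ ρ′ S′ → negOnePow (ρ′ + S′)) rankSum′ sum′ ⟨
        negOnePow (rankSum (w ++ [ x ]) (R₂ ++ [ y ]) + sum (Q₂ ++ [ suc (length w) ])) ∎
        where
        open ≡-Reasoning
        L G₁ G₂ ρ S : ℕ
        L  = below y w
        G₁ = above x R₁
        G₂ = above x R₂
        ρ  = rankSum w R₂
        S  = sum Q₂
        rankSum′ : rankSum (w ++ [ x ]) (R₂ ++ [ y ]) ≡ ρ + G₂ + suc L
        rankSum′ = trans (rankSum-row-∷ʳ (w ++ [ x ]) R₂ y)
                         (cong₂ _+_ (rankSum-word-∷ʳ w x R₂) (below-∷ʳ-< w x<y))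
        sum′ : sum (Q₂ ++ [ suc (length w) ]) ≡ S + suc (L + G₁)
        sum′ = trans (sum-++ Q₂ [ suc (length w) ]) (cong (S +_) (trans (+-identityʳ _) (cong suc length-bump)))
        rearrange : ∀ l g₁ g₂ r s →
                    suc l + suc l + (g₁ + g₂ + (r + s)) ≡ (r + g₂ + suc l) + (s + suc (l + g₁))
        rearrange = solve-∀

      content-bump : w ++ [ x ] ↭ R₁′ ++ (R₂ ++ [ y ])
      content-bump = begin
        w ++ [ x ]            ↭⟨ content-append x ⟩
        (R₁ ++ [ x ]) ++ R₂   ↭⟨ ++⁺ʳ R₂ (↭-sym exchange) ⟩
        (R₁′ ++ [ y ]) ++ R₂  ≡⟨ ++-assoc R₁′ [ y ] R₂ ⟩
        R₁′ ++ ([ y ] ++ R₂)  ↭⟨ ++⁺ˡ R₁′ (++-comm [ y ] R₂) ⟩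
        R₁′ ++ (R₂ ++ [ y ])  ∎
        where open PermutationReasoning

      descent-bump : ∀ {r b} → r ∈ R₁′ → b ∈ R₂ ++ [ y ] → r < b → DescentAbove r (w ++ [ x ])
      descent-bump {r} r∈R₁′ b∈ r<b with r ≤? x
      ... | yes r≤x = y , x , Sublist.++⁺ (from∈ (∈R₁⇒∈w y∈R)) ⊆-refl , x<y , r≤x
      ... | no  r≰x with ∈-++⁻ R₁ (∈-resp-↭ exchange (∈-++⁺ˡ r∈R₁′))
      ...   | inj₂ (here refl) = contradiction ≤-refl r≰x
      ...   | inj₁ r∈R₁ with All.lookup gap r∈R₁ | ∈-++⁻ R₂ b∈
      ...     | inj₁ r<x | _                = contradiction (<⇒≤ r<x) r≰x
      ...     | inj₂ y≤r | inj₂ (here refl) = contradiction y≤r (<⇒≱ r<b)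
      ...     | inj₂ _   | inj₁ b∈R₂        = DescentAbove-++ʳ [ x ] (descent r∈R₁ b∈R₂ r<b)

      invariant-bump : TwoRowInvariant (w ++ [ x ]) R₁′ (R₂ ++ [ y ]) (Q₂ ++ [ suc (length w) ])
      invariant-bump = record
        { content   = content-bump
        ; sorted    = Bump.sorted b
        ; descent   = descent-bump
        ; schensted = schensted-step schensted (rowStep-bump b)
        ; parity    = parity-bump
        }

twoRow : List ℕ → List ℕ → Tableau
twoRow R₁ []          = R₁ ∷ []
twoRow R₁ R₂@(_ ∷ _)  = R₁ ∷ R₂ ∷ []

secondRow-twoRow : ∀ R₁ R₂ → secondRow (twoRow R₁ R₂) ≡ R₂
secondRow-twoRow R₁ []      = refl
secondRow-twoRow R₁ (_ ∷ _) = refl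

insertionStep : ℕ → ℕ → Tableau × Tableau → Tableau × Tableau
insertionStep t x (P , Q) = proj₁ (insertT x P) , addAt t (proj₂ (insertT x P)) Q

rskFrom-∷ : ∀ t x xs P Q → rskFrom t (x ∷ xs) (P , Q) ≡ rskFrom (suc t) xs (insertionStep t x (P , Q))
rskFrom-∷ t x xs P Q with insertT x P
... | _ = refl

insertionStep-append : ∀ {t x R₁ Q₁} R₂ Q₂ → All (_< x) R₁ →
  insertionStep t x (twoRow R₁ R₂ , twoRow Q₁ Q₂) ≡ (twoRow (R₁ ++ [ x ]) R₂ , twoRow (Q₁ ++ [ t ]) Q₂)
insertionStep-append []      []      R₁<x rewrite rowInsert-append R₁<x = refl
insertionStep-append []      (_ ∷ _) R₁<x rewrite rowInsert-append R₁<x = refl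
insertionStep-append (_ ∷ _) []      R₁<x rewrite rowInsert-append R₁<x = refl
insertionStep-append (_ ∷ _) (_ ∷ _) R₁<x rewrite rowInsert-append R₁<x = refl

insertionStep-bump : ∀ {t x y R₁ R₁′ Q₁} R₂ Q₂ → rowInsert x R₁ ≡ (just y , R₁′) → All (_< y) R₂ →
  insertionStep t x (twoRow R₁ R₂ , twoRow Q₁ Q₂) ≡ (twoRow R₁′ (R₂ ++ [ y ]) , twoRow Q₁ (Q₂ ++ [ t ]))
insertionStep-bump []      []      eq _    rewrite eq = refl
insertionStep-bump []      (_ ∷ _) eq _    rewrite eq = refl
insertionStep-bump (_ ∷ _) []      eq R₂<y rewrite eq | rowInsert-append R₂<y = refl
insertionStep-bump (_ ∷ _) (_ ∷ _) eq R₂<y rewrite eq | rowInsert-append R₂<y = refl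

record TwoRowState (w : List ℕ) (PQ : Tableau × Tableau) : Set where
  constructor state
  field
    {R₁ R₂ Q₁ Q₂} : List ℕ
    shape         : PQ ≡ (twoRow R₁ R₂ , twoRow Q₁ Q₂)
    invariant     : TwoRowInvariant w R₁ R₂ Q₂

insertionStep-state : ∀ {w x PQ} → Unique (w ++ [ x ]) → ¬ Contains321 (w ++ [ x ]) →
                      TwoRowState w PQ → TwoRowState (w ++ [ x ]) (insertionStep (suc (length w)) x PQ)
insertionStep-state {w} distinct no321 (state {R₁} {R₂} {Q₁} {Q₂} refl I)
  with rowInsertion (TwoRowInvariant.sorted I) (fresh∉R₁ I distinct)
... | append R₁<x = state (insertionStep-append R₂ Q₂ R₁<x) (invariant-append I R₁<x)
... | bump eq b   = state (insertionStep-bump R₂ Q₂ eq R₂<y) (invariant-bump I b R₂<y)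
  where
  R₂<y : All (_< _) R₂
  R₂<y = R₂-below-bumped I b (Unique-++⁻ˡ w distinct) no321

rskFrom-state : ∀ xs {w PQ} → Unique (w ++ xs) → ¬ Contains321 (w ++ xs) →
                TwoRowState w PQ → TwoRowState (w ++ xs) (rskFrom (suc (length w)) xs PQ)
rskFrom-state []       {w} {PQ} _ _ st = subst (λ w′ → TwoRowState w′ PQ) (sym (++-identityʳ w)) st
rskFrom-state (x ∷ xs) {w} {P , Q} distinct no321 st =
  subst₂ TwoRowState (++-assoc w [ x ] xs) rskFrom-w (rskFrom-state xs distinct′ no321′ st′)
  where
  distinct′ : Unique ((w ++ [ x ]) ++ xs)
  distinct′ = subst Unique (sym (++-assoc w [ x ] xs)) distinct
  no321′ : ¬ Contains321 ((w ++ [ x ]) ++ xs)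
  no321′ = subst (¬_ ∘ Contains321) (sym (++-assoc w [ x ] xs)) no321
  PQ′ : Tableau × Tableau
  PQ′ = insertionStep (suc (length w)) x (P , Q)
  st′ : TwoRowState (w ++ [ x ]) PQ′
  st′ = insertionStep-state (Unique-++⁻ˡ (w ++ [ x ]) distinct′)
                            (no321′ ∘ Contains321-⊆ (Sublist.++⁺ʳ xs ⊆-refl)) st
  rskFrom-w : rskFrom (suc (length (w ++ [ x ]))) xs PQ′ ≡ rskFrom (suc (length w)) (x ∷ xs) (P , Q)
  rskFrom-w = trans (cong (λ t → rskFrom (suc t) xs PQ′) (length-∷ʳ w x)) (sym (rskFrom-∷ _ x xs P Q))

-- rsk starts from the empty tableau, which is not of the form twoRow R₁ R₂; after the first
-- letter it is twoRow [ x ] [] by computation.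
rsk-state : ∀ x xs → Unique (x ∷ xs) → ¬ Contains321 (x ∷ xs) → TwoRowState (x ∷ xs) (rsk (x ∷ xs))
rsk-state x xs distinct no321 = rskFrom-state xs distinct no321 (state refl (invariant-append invariant-[] []))

srs-twoRow : ∀ {w R₁ R₂ Q₁ Q₂} → rsk w ≡ (twoRow R₁ R₂ , twoRow Q₁ Q₂) → srs w ≡ sum R₂ + sum Q₂
srs-twoRow {w} {R₁} {R₂} {Q₁} {Q₂} eq rewrite eq =
  cong₂ (λ S T → sum S + sum T) (secondRow-twoRow R₁ R₂) (secondRow-twoRow Q₁ Q₂)

-- Permutations of 1, …, n

below-map-suc : ∀ v xs → below (suc v) (map suc xs) ≡ below v xs
below-map-suc v []       = refl
below-map-suc v (x ∷ xs) with x <ᵇ v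
... | true  = cong suc (below-map-suc v xs)
... | false = below-map-suc v xs

below-upTo : ∀ {i n} → i ≤ n → below i (upTo n) ≡ i
below-upTo {zero}  {n}     _         = count-none (_<? 0) (All.universal (λ _ ()) (upTo n))
below-upTo {suc i} {suc n} (s≤s i≤n) = cong suc (begin
  below (suc i) (applyUpTo suc n)     ≡⟨ cong (below (suc i)) (map-upTo suc n) ⟨
  below (suc i) (map suc (upTo n))    ≡⟨ below-map-suc i (upTo n) ⟩
  below i (upTo n)                    ≡⟨ below-upTo i≤n ⟩
  i                                   ∎)
  where open ≡-Reasoning

module _ {π n} (π↭ : π ↭ map suc (upTo n)) where

  perm-length : length π ≡ n
  perm-length = trans (↭-length π↭) (trans (length-map suc (upTo n)) (length-upTo n))

  perm-Unique : Unique π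
  perm-Unique = Unique-resp-↭ (↭-sym π↭) (Unique.map⁺ suc-injective (Unique.upTo⁺ n))

  perm-∈⇒< : ∀ {b} → b ∈ π → b < suc n
  perm-∈⇒< b∈π with ∈-map⁻ suc (∈-resp-↭ π↭ b∈π)
  ... | i , i∈ , refl = s≤s (∈-upTo⁻ i∈)

  perm-below : ∀ {b} → b ∈ π → suc (below b π) ≡ b
  perm-below b∈π with ∈-map⁻ suc (∈-resp-↭ π↭ b∈π)
  ... | i , i∈ , refl = cong suc (begin
    below (suc i) π                   ≡⟨ count-↭ (_<? suc i) π↭ ⟩
    below (suc i) (map suc (upTo n))  ≡⟨ below-map-suc i (upTo n) ⟩
    below i (upTo n)                  ≡⟨ below-upTo (<⇒≤ (∈-upTo⁻ i∈)) ⟩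
    i                                 ∎)
    where open ≡-Reasoning

  perm-rankSum : ∀ {R} → All (_∈ π) R → rankSum π R + length R ≡ sum R
  perm-rankSum []                = refl
  perm-rankSum {b ∷ R} (b∈π ∷ R⊆π) = begin
    below b π + rankSum π R + suc (length R) ≡⟨ regroup (below b π) (rankSum π R) (length R) ⟩
    suc (below b π) + (rankSum π R + length R) ≡⟨ cong₂ _+_ (perm-below b∈π) (perm-rankSum R⊆π) ⟩
    b + sum R ∎
    where
    open ≡-Reasoning
    regroup : ∀ c r l → c + r + suc l ≡ suc c + (r + l)
    regroup = solve-∀

  module _ {R₁ R₂ Q₂} (I : TwoRowInvariant π R₁ R₂ Q₂) where
    open TwoRowInvariant I

    sign-twoRow : sign π ≡ negOnePow (sum R₂ + sum Q₂ + length R₂)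
    sign-twoRow = begin
      negOnePow (inv π)
        ≡⟨ parity ⟩
      negOnePow (rankSum π R₂ + sum Q₂)
        ≡⟨ negOnePow-double+ (length R₂) _ ⟨
      negOnePow (length R₂ + length R₂ + (rankSum π R₂ + sum Q₂))
        ≡⟨ cong negOnePow (regroup (length R₂) (rankSum π R₂) (sum Q₂)) ⟩
      negOnePow (rankSum π R₂ + length R₂ + sum Q₂ + length R₂)
        ≡⟨ cong (λ s → negOnePow (s + sum Q₂ + length R₂)) rankSum-R₂ ⟩
      negOnePow (sum R₂ + sum Q₂ + length R₂) ∎
      where
      open ≡-Reasoning
      rankSum-R₂ : rankSum π R₂ + length R₂ ≡ sum R₂
      rankSum-R₂ = perm-rankSum (All.tabulate (∈R₂⇒∈w I))
      regroup : ∀ l r s → l + l + (r + s) ≡ r + l + s + l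
      regroup = solve-∀

    n∸lis≡length-R₂ : ∀ {k} → IsLIS π k → n ∸ k ≡ length R₂
    n∸lis≡length-R₂ {k} lis = begin
      n ∸ k                              ≡⟨ cong₂ _∸_ n≡ k≡ ⟩
      length R₁ + length R₂ ∸ length R₁  ≡⟨ m+n∸m≡n (length R₁) (length R₂) ⟩
      length R₂                          ∎
      where
      open ≡-Reasoning
      n≡ : n ≡ length R₁ + length R₂
      n≡ = trans (sym perm-length) (trans (↭-length content) (length-++ R₁))
      below-R₁ : below (suc n) R₁ ≡ length R₁
      below-R₁ = count-all (_<? suc n) (All.tabulate (perm-∈⇒< ∘ ∈R₁⇒∈w I))
      k≡ : k ≡ length R₁
      k≡ = IsLIS-unique lis (subst (IsLIS π) below-R₁ (schensted-lis schensted (All.tabulate perm-∈⇒<)))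

proposition2p1 : (n : ℕ) (π : List ℕ) (k : ℕ) →
    π ↭ map suc (upTo n) → Avoids321 π → IsLIS π k →
    sign π ≡ negOnePow (srs π + (n ∸ k))
proposition2p1 n [] k π↭ _ _ =
  cong negOnePow (sym (trans (cong (_∸ k) (sym (perm-length π↭))) (0∸n≡0 k)))
proposition2p1 n π@(x ∷ xs) k π↭ avoids lis = begin
  sign π
    ≡⟨ sign-twoRow π↭ invariant ⟩
  negOnePow (sum R₂ + sum Q₂ + length R₂)
    ≡⟨ cong₂ (λ s m → negOnePow (s + m)) (srs-twoRow {π} shape) (n∸lis≡length-R₂ π↭ invariant lis) ⟨
  negOnePow (srs π + (n ∸ k)) ∎
  where
  open ≡-Reasoning
  open TwoRowState (rsk-state x xs (perm-Unique π↭) (Avoids321⇒¬Contains321 avoids))
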